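{- Let $S$ be a read-$k$ sequence over a set $X=\{x_1,\dots,x_n\}$, where the elements are labeled so that their first occurrences in $S$ appear in the order $x_1,\dots,x_n$. Then there exists $X'\subseteq X$ with $|X'|\ge n^{1/2^{k-1}}$ such that $S|_{X'}$ is per-read-monotone.
   Context: A sequence $S$ of elements of a finite set $X$ is read-$k$ if every element of $X$ occurs exactly $k$ times in $S$. For $i\in[k]$, $S^{(i)}$ denotes the subsequence of $S$ consisting of the $i$-th occurrences of the elements. For $X'\subseteq X$, $S|_{X'}$ is obtained by deleting all occurrences of elements of $X\setminus X'$. $X$ is ordered by $x_1<\dots<x_n$. A read-$k$ sequence is per-read-monotone if for every $i\in[k]$, $S^{(i)}$ is monotone (increasing or decreasing) with respect to this order. -}

module Defs where

open import Data.Nat using (ℕ; zero; suc; _+_; _≡ᵇ_)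
open import Data.Bool using (Bool; true; false; if_then_else_)
open import Data.Fin using (Fin; _<_; _>_)
open import Data.Fin.Properties using (_≟_)
open import Data.Fin.Subset using (Subset)
open import Data.Fin.Subset.Properties using (_∈?_)
open import Data.List using (List; []; _∷_; length; filter)
open import Data.List.Relation.Unary.Linked using (Linked)
open import Data.Sum using (_⊎_)
open import Relation.Binary.PropositionalEquality using (_≡_)

-- Sequences over X = Fin n (x₁ < … < xₙ is the order 0 < … < n-1 of Fin n).

count : ∀ {n} → Fin n → List (Fin n) → ℕ
count x S = length (filter (_≟ x) S)

ReadK : ∀ {n} → ℕ → List (Fin n) → Set
ReadK k S = ∀ x → count x S ≡ k

-- S^(i): subsequence of the i-th occurrences (i is 1-based).
-- `seen` is the (reversed) prefix already scanned.
nthOccGo : ∀ {n} → ℕ → List (Fin n) → List (Fin n) → List (Fin n)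
nthOccGo i seen [] = []
nthOccGo i seen (x ∷ xs) =
  if suc (count x seen) ≡ᵇ i
    then x ∷ nthOccGo i (x ∷ seen) xs
    else nthOccGo i (x ∷ seen) xs

nthOcc : ∀ {n} → ℕ → List (Fin n) → List (Fin n)
nthOcc i S = nthOccGo i [] S

restrict : ∀ {n} → Subset n → List (Fin n) → List (Fin n)
restrict X' S = filter (_∈? X') S

Monotone : ∀ {n} → List (Fin n) → Set
Monotone xs = Linked _<_ xs ⊎ Linked _>_ xs

PerReadMonotone : ∀ {n} → ℕ → List (Fin n) → Set
PerReadMonotone k S = ∀ i → 1 Data.Nat.≤ i → i Data.Nat.≤ k → Monotone (nthOcc i S)

module Submission where

-- Induct on the number of reads handled.  Keep a
-- set X of elements such that restricting S to X makes S^(1), …, S^(j+1)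
-- monotone, with n ≤ |X|^(2^j).  Initially X is everything: S^(1) lists the
-- elements in order, so it is increasing.  For the next read T = S^(j+2),
-- which lists every element exactly once, the restriction T|X has |X|
-- distinct entries, so by the Erdős–Szekeres theorem it has a monotone
-- sublist s with |X| ≤ |s|².  Taking Y = entries of s, T|Y ⊆ s is monotone,
-- earlier reads stay monotone since Y ⊆ X, and n ≤ |X|^(2^j) ≤ |Y|^(2^(j+1)).
-- Finally, i-th occurrences commute with restriction, so (S|X)^(i) = S^(i)|X.

open import Defs
open import Level using (Level; _⊔_)
open import Data.Nat as ℕ using (ℕ; zero; suc; _+_; _*_; _^_; _∸_; _≤_; _<_; z≤n; s≤s; _≡ᵇ_)
import Data.Nat.Properties as ℕP
open import Data.Nat.Induction using (<-wellFounded)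
open import Data.Bool using (true; false)
open import Data.Unit using (tt)
open import Data.Fin as Fin using (Fin)
open import Data.Fin.Properties using (_≟_; <-isStrictTotalOrder)
open import Data.Fin.Subset
  using (Subset; ∣_∣; _∈_; ⁅_⁆; _∪_; _-_; ⊥; ⊤; inside; outside) renaming (_⊆_ to _⊆ₛ_)
open import Data.Fin.Subset.Properties
  using (_∈?_; x∈p∪q⁺; x∈p∪q⁻; x∈⁅x⁆; x∈⁅y⁆⇒x≡y; ∉⊥; ∪-identityˡ; ∣p∣≤∣x∷p∣; ∣⊥∣≡0; ∣⊤∣≡n
        ; p⊆q⇒∣p∣≤∣q∣; x∈p⇒∣p-x∣<∣p∣; x∈p∧x≢y⇒x∈p-y)
open import Data.Vec using ([]; _∷_)
open import Data.List using (List; []; _∷_; length; filter; foldr; allFin)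
open import Data.List.Properties using (filter-accept; filter-reject)
open import Data.List.Membership.Propositional using () renaming (_∈_ to _∈ₗ_)
open import Data.List.Membership.Propositional.Properties using (∈-filter⁺; ∈-filter⁻)
open import Data.List.Relation.Binary.Sublist.Propositional
  using (_⊆_; []; _∷_; _∷ʳ_; ⊆-refl; ⊆-trans; minimum; lookup)
open import Data.List.Relation.Binary.Sublist.Propositional.Properties
  using (length-mono-≤; filter-⊆; filter⁺)
open import Data.List.Relation.Unary.All as All using (All; []; _∷_)
open import Data.List.Relation.Unary.AllPairs using (AllPairs; []; _∷_)
import Data.List.Relation.Unary.AllPairs.Properties as AllPairs
open import Data.List.Relation.Unary.Any using (here; there)
open import Data.List.Relation.Unary.Linked using (Linked; []; [-]; _∷_)
open import Data.List.Relation.Unary.Linked.Properties using (AllPairs⇒Linked; Linked⇒AllPairs)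
open import Data.List.Relation.Unary.Unique.Propositional using (Unique)
import Data.List.Relation.Unary.Unique.Propositional.Properties as Unique
open import Data.Product using (Σ; ∃; _×_; _,_; proj₂)
open import Data.Sum using (_⊎_; inj₁; inj₂)
open import Data.Empty using (⊥-elim)
open import Function using (id; flip; _∘_)
open import Induction.WellFounded using (Acc; acc)
open import Relation.Binary using (Rel; Transitive; IsStrictTotalOrder; tri<; tri≈; tri>)
open import Relation.Binary.PropositionalEquality
  using (_≡_; _≢_; refl; sym; trans; cong; subst; module ≡-Reasoning)
open import Relation.Nullary using (yes; no)
open import Relation.Unary using (Pred; Decidable)

private
  variable
    a ℓ : Level
    A : Set a

AllPairs-⊆ : {R : Rel A ℓ} {xs ys : List A} → xs ⊆ ys → AllPairs R ys → AllPairs R xs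
AllPairs-⊆ []         []         = []
AllPairs-⊆ (y ∷ʳ σ)   (_  ∷ ps)  = AllPairs-⊆ σ ps
AllPairs-⊆ (refl ∷ σ) (px ∷ ps)  =
  All.tabulate (λ z∈xs → All.lookup px (lookup σ z∈xs)) ∷ AllPairs-⊆ σ ps

-- For a transitive relation, chains are exactly the lists related pairwise,
-- so sublists of chains are chains.
Linked-⊆ : {R : Rel A ℓ} → Transitive R → {xs ys : List A} → xs ⊆ ys → Linked R ys → Linked R xs
Linked-⊆ trans σ chain = AllPairs⇒Linked (AllPairs-⊆ σ (Linked⇒AllPairs trans chain))

∈-tail : {x z : A} {s l : List A} → All (x ≢_) l → z ∈ₗ l → z ∈ₗ x ∷ s → z ∈ₗ s
∈-tail x∉l z∈l (here z≡x)  = ⊥-elim (All.lookup x∉l z∈l (sym z≡x))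
∈-tail x∉l z∈l (there z∈s) = z∈s

filter⊆sublist : {P : Pred A ℓ} (P? : Decidable P) {s l : List A} → s ⊆ l → Unique l →
                  (∀ {z} → z ∈ₗ l → P z → z ∈ₗ s) → filter P? l ⊆ s
filter⊆sublist P? []         _            _ = []
filter⊆sublist P? (y ∷ʳ σ)   (y∉l ∷ uniq) P⇒∈s with P? y
... | yes Py = ⊥-elim (All.lookup y∉l (lookup σ (P⇒∈s (here refl) Py)) refl)
... | no  _  = filter⊆sublist P? σ uniq (λ z∈l → P⇒∈s (there z∈l))
filter⊆sublist P? {x ∷ _} (refl ∷ σ) (x∉l ∷ uniq) P⇒∈s with P? x
... | yes _ = refl ∷ filter⊆sublist P? σ uniq (λ z∈l Pz → ∈-tail x∉l z∈l (P⇒∈s (there z∈l) Pz))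
... | no  _ = x ∷ʳ filter⊆sublist P? σ uniq (λ z∈l Pz → ∈-tail x∉l z∈l (P⇒∈s (there z∈l) Pz))

module ErdősSzekeres {A : Set a} {_<_ : Rel A ℓ} (sto : IsStrictTotalOrder _≡_ _<_) where

  open IsStrictTotalOrder sto using (compare; _<?_) renaming (trans to <-trans)

  _>_ : Rel A ℓ
  _>_ = flip _<_

  >-trans : Transitive _>_
  >-trans p q = <-trans q p

  descent : A → List A → List A
  descent m []       = []
  descent m (x ∷ xs) with x <? m
  ... | yes _ = x ∷ descent x xs
  ... | no  _ = descent m xs

  leftover : A → List A → List A
  leftover m []       = []
  leftover m (x ∷ xs) with x <? m
  ... | yes _ = leftover x xs
  ... | no  _ = x ∷ leftover m xs

  descent-decreasing : ∀ m xs → Linked _>_ (m ∷ descent m xs)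
  descent-decreasing m []       = [-]
  descent-decreasing m (x ∷ xs) with x <? m
  ... | yes x<m = x<m ∷ descent-decreasing x xs
  ... | no  _   = descent-decreasing m xs

  descent-⊆ : ∀ m xs → descent m xs ⊆ xs
  descent-⊆ m []       = []
  descent-⊆ m (x ∷ xs) with x <? m
  ... | yes _ = refl ∷ descent-⊆ x xs
  ... | no  _ = x ∷ʳ descent-⊆ m xs

  leftover-⊆ : ∀ m xs → leftover m xs ⊆ xs
  leftover-⊆ m []       = []
  leftover-⊆ m (x ∷ xs) with x <? m
  ... | yes _ = x ∷ʳ leftover-⊆ x xs
  ... | no  _ = refl ∷ leftover-⊆ m xs

  length-partition : ∀ m xs → length xs ≡ length (descent m xs) + length (leftover m xs)
  length-partition m []       = refl
  length-partition m (x ∷ xs) with x <? m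
  ... | yes _ = cong suc (length-partition x xs)
  ... | no  _ = trans (cong suc (length-partition m xs)) (sym (ℕP.+-suc _ _))

  -- A leftover y of m ∷ xs was not below the descent element current when y
  -- was scanned; that element precedes y and (by distinctness) is smaller
  -- than y, so any run y ∷ ys of leftovers can be preceded by it.
  precede : ∀ m xs {y ys} → Unique (m ∷ xs) → y ∷ ys ⊆ leftover m xs →
            ∃ λ w → w < y × w ∷ y ∷ ys ⊆ m ∷ xs
  precede m (x ∷ xs) uniq σ with x <? m
  ... | yes _ with precede x xs (AllPairs-⊆ (_ ∷ʳ ⊆-refl) uniq) σ
  ...   | w , w<y , τ = w , w<y , m ∷ʳ τ
  precede m (x ∷ xs) uniq (x ∷ʳ σ) | no _ with precede m xs (AllPairs-⊆ (refl ∷ x ∷ʳ ⊆-refl) uniq) σ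
  ...   | w , w<y , τ = w , w<y , ⊆-trans τ (refl ∷ x ∷ʳ ⊆-refl)
  precede m (x ∷ xs) ((m≢x ∷ _) ∷ _) (refl ∷ σ) | no x≮m with compare m x
  ...   | tri< m<x _ _   = m , m<x , refl ∷ refl ∷ ⊆-trans σ (leftover-⊆ m xs)
  ...   | tri≈ _ m≡x _   = ⊥-elim (m≢x m≡x)
  ...   | tri> _ _ x<m   = ⊥-elim (x≮m x<m)

  extend : ∀ m xs {inc} → Unique (m ∷ xs) → inc ⊆ leftover m xs → Linked _<_ inc →
           ∃ λ w → w ∷ inc ⊆ m ∷ xs × Linked _<_ (w ∷ inc)
  extend m xs {[]}    _    _ _     = m , refl ∷ minimum xs , [-]
  extend m xs {_ ∷ _} uniq σ chain with precede m xs uniq σ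
  ... | w , w<y , τ = w , τ , w<y ∷ chain

  record IncDec (l : List A) : Set (a ⊔ ℓ) where
    field
      inc dec    : List A
      inc-⊆      : inc ⊆ l
      dec-⊆      : dec ⊆ l
      increasing : Linked _<_ inc
      decreasing : Linked _>_ dec
      bound      : length l ≤ length inc * length dec

  -- Take the greedy descent D from the head x, recurse on the leftovers r to
  -- get inc′, dec′ with |r| ≤ |inc′|·|dec′|, extend inc′ by one element and let
  -- dec be the longer of D and dec′:  |l| = |D| + |r| ≤ (1 + |inc′|)·|dec|.
  erdősSzekeres : (l : List A) → Unique l → IncDec l
  erdősSzekeres l = go l (<-wellFounded (length l))
    where
    go : (l : List A) → Acc ℕ._<_ (length l) → Unique l → IncDec l
    go []       _      _               = record
      { inc = [] ; dec = [] ; inc-⊆ = [] ; dec-⊆ = [] ; increasing = [] ; decreasing = [] ; bound = z≤n }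
    go (x ∷ xs) (acc rs) uniq@(_ ∷ uniq′) =
      combine (extend x xs uniq inc-⊆ increasing) (ℕP.≤-total (length D) (length dec′))
      where
      D = x ∷ descent x xs
      r = leftover x xs
      IH : IncDec r
      IH = go r (rs (s≤s (length-mono-≤ (leftover-⊆ x xs)))) (AllPairs-⊆ (leftover-⊆ x xs) uniq′)
      open IncDec IH renaming (inc to inc′; dec to dec′; dec-⊆ to dec′-⊆)
      bound-by : ∀ M → length D ≤ M → length dec′ ≤ M → length (x ∷ xs) ≤ (1 + length inc′) * M
      bound-by M D≤M dec′≤M = ℕP.≤-trans (ℕP.≤-reflexive (cong suc (length-partition x xs)))
        (ℕP.+-mono-≤ D≤M (ℕP.≤-trans bound (ℕP.*-monoʳ-≤ (length inc′) dec′≤M)))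
      combine : (∃ λ w → w ∷ inc′ ⊆ x ∷ xs × Linked _<_ (w ∷ inc′)) →
                length D ≤ length dec′ ⊎ length dec′ ≤ length D → IncDec (x ∷ xs)
      combine (w , τ , incr) (inj₁ D≤dec′) = record
        { inc = w ∷ inc′ ; dec = dec′ ; inc-⊆ = τ ; dec-⊆ = x ∷ʳ ⊆-trans dec′-⊆ (leftover-⊆ x xs)
        ; increasing = incr ; decreasing = decreasing
        ; bound = bound-by (length dec′) D≤dec′ ℕP.≤-refl }
      combine (w , τ , incr) (inj₂ dec′≤D) = record
        { inc = w ∷ inc′ ; dec = D ; inc-⊆ = τ ; dec-⊆ = refl ∷ descent-⊆ x xs
        ; increasing = incr ; decreasing = descent-decreasing x xs
        ; bound = bound-by (length D) ℕP.≤-refl dec′≤D }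

  Monotonic : List A → Set (a ⊔ ℓ)
  Monotonic xs = Linked _<_ xs ⊎ Linked _>_ xs

  monotonic-⊆ : {xs ys : List A} → xs ⊆ ys → Monotonic ys → Monotonic xs
  monotonic-⊆ σ (inj₁ incr) = inj₁ (Linked-⊆ <-trans σ incr)
  monotonic-⊆ σ (inj₂ decr) = inj₂ (Linked-⊆ >-trans σ decr)

  monotonic-sublist : (l : List A) → Unique l →
                      ∃ λ s → s ⊆ l × Monotonic s × length l ≤ length s * length s
  monotonic-sublist l uniq = longer (ℕP.≤-total (length inc) (length dec))
    where
    open IncDec (erdősSzekeres l uniq)
    longer : length inc ≤ length dec ⊎ length dec ≤ length inc →
             ∃ λ s → s ⊆ l × Monotonic s × length l ≤ length s * length s
    longer (inj₁ inc≤dec) = dec , dec-⊆ , inj₂ decreasing , ℕP.≤-trans bound (ℕP.*-monoˡ-≤ (length dec) inc≤dec)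
    longer (inj₂ dec≤inc) = inc , inc-⊆ , inj₁ increasing , ℕP.≤-trans bound (ℕP.*-monoʳ-≤ (length inc) dec≤inc)

entries : ∀ {n} → List (Fin n) → Subset n
entries = foldr (λ x p → ⁅ x ⁆ ∪ p) ⊥

∈-entries⁺ : ∀ {n} {x : Fin n} {l} → x ∈ₗ l → x ∈ entries l
∈-entries⁺ {l = y ∷ l} (here refl) = x∈p∪q⁺ (inj₁ (x∈⁅x⁆ y))
∈-entries⁺ {l = y ∷ l} (there x∈l) = x∈p∪q⁺ (inj₂ (∈-entries⁺ x∈l))

∈-entries⁻ : ∀ {n} {x : Fin n} l → x ∈ entries l → x ∈ₗ l
∈-entries⁻ [] x∈⊥ = ⊥-elim (∉⊥ x∈⊥)
∈-entries⁻ (y ∷ l) x∈ with x∈p∪q⁻ ⁅ y ⁆ (entries l) x∈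
... | inj₁ x∈⁅y⁆ = here (x∈⁅y⁆⇒x≡y y x∈⁅y⁆)
... | inj₂ x∈l   = there (∈-entries⁻ l x∈l)

∣⁅x⁆∪p∣≤1+∣p∣ : ∀ {n} (x : Fin n) (p : Subset n) → ∣ ⁅ x ⁆ ∪ p ∣ ≤ suc ∣ p ∣
∣⁅x⁆∪p∣≤1+∣p∣ Fin.zero    (s ∷ p)       =
  s≤s (ℕP.≤-trans (ℕP.≤-reflexive (cong ∣_∣ (∪-identityˡ p))) (∣p∣≤∣x∷p∣ s p))
∣⁅x⁆∪p∣≤1+∣p∣ (Fin.suc x) (inside  ∷ p) = s≤s (∣⁅x⁆∪p∣≤1+∣p∣ x p)
∣⁅x⁆∪p∣≤1+∣p∣ (Fin.suc x) (outside ∷ p) = ∣⁅x⁆∪p∣≤1+∣p∣ x p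

∣entries∣≤length : ∀ {n} (l : List (Fin n)) → ∣ entries l ∣ ≤ length l
∣entries∣≤length {n} []      = ℕP.≤-reflexive (∣⊥∣≡0 n)
∣entries∣≤length     (x ∷ l) = ℕP.≤-trans (∣⁅x⁆∪p∣≤1+∣p∣ x (entries l)) (s≤s (∣entries∣≤length l))

∣∣≤length : ∀ {n} (X : Subset n) (l : List (Fin n)) → (∀ {x} → x ∈ X → x ∈ₗ l) → ∣ X ∣ ≤ length l
∣∣≤length X l X⊆l = ℕP.≤-trans (p⊆q⇒∣p∣≤∣q∣ (∈-entries⁺ ∘ X⊆l)) (∣entries∣≤length l)

length≤∣∣ : ∀ {n} (Y : Subset n) (l : List (Fin n)) → Unique l → (∀ {x} → x ∈ₗ l → x ∈ Y) → length l ≤ ∣ Y ∣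
length≤∣∣ Y [] _ _ = z≤n
length≤∣∣ Y (y ∷ l) (y∉l ∷ uniq) l⊆Y =
  ℕP.<-≤-trans (s≤s (length≤∣∣ (Y - y) l uniq l⊆Y-y)) (x∈p⇒∣p-x∣<∣p∣ (l⊆Y (here refl)))
  where
  l⊆Y-y : ∀ {x} → x ∈ₗ l → x ∈ Y - y
  l⊆Y-y x∈l = x∈p∧x≢y⇒x∈p-y (l⊆Y (there x∈l)) (λ x≡y → All.lookup y∉l x∈l (sym x≡y))

module _ {n : ℕ} where

  count-here : (x : Fin n) (l : List (Fin n)) → count x (x ∷ l) ≡ suc (count x l)
  count-here x l = cong length (filter-accept (_≟ x) refl)

  count-there : {x y : Fin n} (l : List (Fin n)) → y ≢ x → count x (y ∷ l) ≡ count x l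
  count-there {x} l y≢x = cong length (filter-reject (_≟ x) y≢x)

  ∈⇒count-pos : {x : Fin n} {l : List (Fin n)} → x ∈ₗ l → 1 ≤ count x l
  ∈⇒count-pos {x} {y ∷ l} x∈ with y ≟ x
  ... | yes refl = s≤s z≤n
  ... | no  y≢x  = ∈⇒count-pos (tail x∈)
    where
    tail : x ∈ₗ y ∷ l → x ∈ₗ l
    tail (here refl) = ⊥-elim (y≢x refl)
    tail (there x∈l) = x∈l

  count-pos⇒∈ : {x : Fin n} (l : List (Fin n)) → 1 ≤ count x l → x ∈ₗ l
  count-pos⇒∈ {x} (y ∷ l) pos with y ≟ x
  ... | yes refl = here refl
  ... | no  y≢x  = there (count-pos⇒∈ l pos)

  count-∷ : (x y : Fin n) (l : List (Fin n)) → count x l ≤ count x (y ∷ l)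
  count-∷ x y l with y ≟ x
  ... | yes _ = ℕP.n≤1+n _
  ... | no  _ = ℕP.≤-refl

  count≤1⇒Unique : (l : List (Fin n)) → (∀ x → count x l ≤ 1) → Unique l
  count≤1⇒Unique []      _     = []
  count≤1⇒Unique (y ∷ l) atMost1 =
    All.tabulate y∉l ∷ count≤1⇒Unique l (λ x → ℕP.≤-trans (count-∷ x y l) (atMost1 x))
    where
    y∉l : ∀ {z} → z ∈ₗ l → y ≢ z
    y∉l z∈l refl = ℕP.<-irrefl refl (begin-strict
      1                  <⟨ s≤s (∈⇒count-pos z∈l) ⟩
      suc (count y l)    ≡⟨ count-here y l ⟨
      count y (y ∷ l)    ≤⟨ atMost1 y ⟩
      1                  ∎)
      where open ℕP.≤-Reasoning

  nthOccGo-emit : ∀ {i} (seen : List (Fin n)) {y} xs → suc (count y seen) ≡ i →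
                  nthOccGo i seen (y ∷ xs) ≡ y ∷ nthOccGo i (y ∷ seen) xs
  nthOccGo-emit {i} seen {y} xs e with suc (count y seen) ≡ᵇ i | ℕP.≡⇒≡ᵇ _ i e
  ... | true | _ = refl

  nthOccGo-pass : ∀ {i} (seen : List (Fin n)) {y} xs → suc (count y seen) ≢ i →
                  nthOccGo i seen (y ∷ xs) ≡ nthOccGo i (y ∷ seen) xs
  nthOccGo-pass {i} seen {y} xs ne with suc (count y seen) ≡ᵇ i | ℕP.≡ᵇ⇒≡ (suc (count y seen)) i
  ... | true  | e = ⊥-elim (ne (e tt))
  ... | false | _ = refl

  count-nthOccGo-other : ∀ {i} (seen : List (Fin n)) {x y} xs → y ≢ x →
                         count x (nthOccGo i seen (y ∷ xs)) ≡ count x (nthOccGo i (y ∷ seen) xs)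
  count-nthOccGo-other {i} seen {x} {y} xs y≢x with suc (count y seen) ℕ.≟ i
  ... | yes e = trans (cong (count x) (nthOccGo-emit seen xs e)) (count-there _ y≢x)
  ... | no ne = cong (count x) (nthOccGo-pass seen xs ne)

  count-nthOccGo-done : ∀ {i} (x : Fin n) seen xs → i ≤ count x seen → count x (nthOccGo i seen xs) ≡ 0
  count-nthOccGo-done x seen []       _   = refl
  count-nthOccGo-done {i} x seen (y ∷ xs) i≤c with y ≟ x
  ... | no y≢x  = trans (count-nthOccGo-other {i} seen xs y≢x)
                        (count-nthOccGo-done x (y ∷ seen) xs (subst (i ≤_) (sym (count-there seen y≢x)) i≤c))
  ... | yes refl = trans (cong (count x) (nthOccGo-pass {i} seen xs (λ e → ℕP.<-irrefl (sym e) (s≤s i≤c))))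
                        (count-nthOccGo-done x (x ∷ seen) xs
                          (subst (i ≤_) (sym (count-here x seen)) (ℕP.m≤n⇒m≤1+n i≤c)))

  count-nthOccGo-pending : ∀ {i} (x : Fin n) seen xs → count x seen < i → i ≤ count x seen + count x xs →
                           count x (nthOccGo i seen xs) ≡ 1
  count-nthOccGo-pending x seen [] c<i i≤c+0 =
    ⊥-elim (ℕP.<-irrefl refl (ℕP.<-≤-trans c<i (ℕP.≤-trans i≤c+0 (ℕP.≤-reflexive (ℕP.+-identityʳ _)))))
  count-nthOccGo-pending {i} x seen (y ∷ xs) c<i i≤c+r with y ≟ x
  ... | no y≢x = trans (count-nthOccGo-other {i} seen xs y≢x)
                       (count-nthOccGo-pending x (y ∷ seen) xs
                         (subst (_< i) (sym (count-there seen y≢x)) c<i)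
                         (subst (λ c → i ≤ c + count x xs) (sym (count-there seen y≢x)) i≤c+r))
  ... | yes refl with suc (count x seen) ℕ.≟ i
  ...   | yes e = begin
          count x (nthOccGo i seen (x ∷ xs))          ≡⟨ cong (count x) (nthOccGo-emit seen xs e) ⟩
          count x (x ∷ nthOccGo i (x ∷ seen) xs)      ≡⟨ count-here x _ ⟩
          suc (count x (nthOccGo i (x ∷ seen) xs))    ≡⟨ cong suc (count-nthOccGo-done x (x ∷ seen) xs i≤c′) ⟩
          1                                           ∎
    where
    open ≡-Reasoning
    i≤c′ : i ≤ count x (x ∷ seen)
    i≤c′ = ℕP.≤-reflexive (trans (sym e) (sym (count-here x seen)))
  ...   | no ne = trans (cong (count x) (nthOccGo-pass seen xs ne))
                        (count-nthOccGo-pending x (x ∷ seen) xs c′<i i≤c′+r)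
    where
    c′<i : count x (x ∷ seen) < i
    c′<i = subst (_< i) (sym (count-here x seen)) (ℕP.≤∧≢⇒< c<i ne)
    i≤c′+r : i ≤ count x (x ∷ seen) + count x xs
    i≤c′+r = subst (λ c → i ≤ c + count x xs) (sym (count-here x seen)) (subst (i ≤_) (ℕP.+-suc _ _) i≤c+r)

  nthOcc-once : ∀ {k i} (S : List (Fin n)) → ReadK k S → 1 ≤ i → i ≤ k → ∀ x → count x (nthOcc i S) ≡ 1
  nthOcc-once {i = i} S readK 1≤i i≤k x =
    count-nthOccGo-pending x [] S 1≤i (subst (i ≤_) (sym (readK x)) i≤k)

  count-restrict : ∀ {X : Subset n} {x} → x ∈ X → (l : List (Fin n)) → count x (restrict X l) ≡ count x l
  count-restrict x∈X [] = refl
  count-restrict {X} {x} x∈X (y ∷ l) with y ∈? X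
  ... | yes y∈X with y ≟ x
  ...   | yes _ = cong suc (count-restrict x∈X l)
  ...   | no  _ = count-restrict x∈X l
  count-restrict {X} {x} x∈X (y ∷ l) | no y∉X with y ≟ x
  ...   | yes refl = ⊥-elim (y∉X x∈X)
  ...   | no  _    = count-restrict x∈X l

-- Taking i-th occurrences commutes with restriction: whether an element of X
-- is emitted depends only on its own earlier occurrences, which restriction keeps.
module _ {n : ℕ} (i : ℕ) (X : Subset n) where

  private
    R : List (Fin n) → List (Fin n)
    R = restrict X

    same-count : ∀ {y} → y ∈ X → ∀ seen → suc (count y (R seen)) ≡ suc (count y seen)
    same-count y∈X seen = cong suc (count-restrict y∈X seen)

  open ≡-Reasoning

  restrict-nthOccGo : ∀ seen xs → nthOccGo i (R seen) (R xs) ≡ R (nthOccGo i seen xs)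
  restrict-nthOccGo seen []       = refl
  restrict-nthOccGo seen (y ∷ xs) with y ∈? X | suc (count y seen) ℕ.≟ i
  ... | yes y∈X | yes e = begin
    nthOccGo i (R seen) (y ∷ R xs)       ≡⟨ nthOccGo-emit (R seen) (R xs) (trans (same-count y∈X seen) e) ⟩
    y ∷ nthOccGo i (y ∷ R seen) (R xs)   ≡⟨ cong (λ s → y ∷ nthOccGo i s (R xs)) (filter-accept (_∈? X) y∈X) ⟨
    y ∷ nthOccGo i (R (y ∷ seen)) (R xs) ≡⟨ cong (y ∷_) (restrict-nthOccGo (y ∷ seen) xs) ⟩
    y ∷ R (nthOccGo i (y ∷ seen) xs)     ≡⟨ filter-accept (_∈? X) y∈X ⟨
    R (y ∷ nthOccGo i (y ∷ seen) xs)     ≡⟨ cong R (nthOccGo-emit seen xs e) ⟨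
    R (nthOccGo i seen (y ∷ xs))         ∎
  ... | yes y∈X | no ne = begin
    nthOccGo i (R seen) (y ∷ R xs)       ≡⟨ nthOccGo-pass (R seen) (R xs) (ne ∘ trans (sym (same-count y∈X seen))) ⟩
    nthOccGo i (y ∷ R seen) (R xs)       ≡⟨ cong (λ s → nthOccGo i s (R xs)) (filter-accept (_∈? X) y∈X) ⟨
    nthOccGo i (R (y ∷ seen)) (R xs)     ≡⟨ restrict-nthOccGo (y ∷ seen) xs ⟩
    R (nthOccGo i (y ∷ seen) xs)         ≡⟨ cong R (nthOccGo-pass seen xs ne) ⟨
    R (nthOccGo i seen (y ∷ xs))         ∎
  ... | no y∉X | yes e = begin
    nthOccGo i (R seen) (R xs)           ≡⟨ cong (λ s → nthOccGo i s (R xs)) (filter-reject (_∈? X) y∉X) ⟨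
    nthOccGo i (R (y ∷ seen)) (R xs)     ≡⟨ restrict-nthOccGo (y ∷ seen) xs ⟩
    R (nthOccGo i (y ∷ seen) xs)         ≡⟨ filter-reject (_∈? X) y∉X ⟨
    R (y ∷ nthOccGo i (y ∷ seen) xs)     ≡⟨ cong R (nthOccGo-emit seen xs e) ⟨
    R (nthOccGo i seen (y ∷ xs))         ∎
  ... | no y∉X | no ne = begin
    nthOccGo i (R seen) (R xs)           ≡⟨ cong (λ s → nthOccGo i s (R xs)) (filter-reject (_∈? X) y∉X) ⟨
    nthOccGo i (R (y ∷ seen)) (R xs)     ≡⟨ restrict-nthOccGo (y ∷ seen) xs ⟩
    R (nthOccGo i (y ∷ seen) xs)         ≡⟨ cong R (nthOccGo-pass seen xs ne) ⟨
    R (nthOccGo i seen (y ∷ xs))         ∎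

module _ {n : ℕ} where

  open ErdősSzekeres (<-isStrictTotalOrder {n}) using (monotonic-sublist; monotonic-⊆)

  refine : (T : List (Fin n)) → Unique T → (∀ x → x ∈ₗ T) → (X : Subset n) →
           ∃ λ Y → Y ⊆ₛ X × ∣ X ∣ ≤ ∣ Y ∣ * ∣ Y ∣ × Monotone (restrict Y T)
  refine T uniq complete X with monotonic-sublist (restrict X T) (Unique.filter⁺ (_∈? X) uniq)
  ... | s , s⊆T|X , s-monotone , |T|X|≤|s|² = entries s , Y⊆X , size , T|Y-monotone
    where
    s⊆T : s ⊆ T
    s⊆T = ⊆-trans s⊆T|X (filter-⊆ (_∈? X) T)
    Y⊆X : entries s ⊆ₛ X
    Y⊆X x∈Y = proj₂ (∈-filter⁻ (_∈? X) {xs = T} (lookup s⊆T|X (∈-entries⁻ s x∈Y)))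
    |X|≤|T|X| : ∣ X ∣ ≤ length (restrict X T)
    |X|≤|T|X| = ∣∣≤length X (restrict X T) (λ {x} x∈X → ∈-filter⁺ (_∈? X) (complete x) x∈X)
    |s|≤|Y| : length s ≤ ∣ entries s ∣
    |s|≤|Y| = length≤∣∣ (entries s) s (AllPairs-⊆ s⊆T uniq) ∈-entries⁺
    size : ∣ X ∣ ≤ ∣ entries s ∣ * ∣ entries s ∣
    size = ℕP.≤-trans |X|≤|T|X| (ℕP.≤-trans |T|X|≤|s|² (ℕP.*-mono-≤ |s|≤|Y| |s|≤|Y|))
    T|Y-monotone : Monotone (restrict (entries s) T)
    T|Y-monotone = monotonic-⊆ (filter⊆sublist (_∈? entries s) s⊆T uniq (λ _ x∈Y → ∈-entries⁻ s x∈Y)) s-monotone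

  ^-square : ∀ {a b} e → a ≤ b * b → a ^ (2 ^ e) ≤ b ^ (2 ^ suc e)
  ^-square {a} {b} e a≤b² = begin
    a ^ (2 ^ e)           ≤⟨ ℕP.^-monoˡ-≤ (2 ^ e) a≤b² ⟩
    (b * b) ^ (2 ^ e)     ≡⟨ cong (λ c → (b * c) ^ (2 ^ e)) (ℕP.*-identityʳ b) ⟨
    (b ^ 2) ^ (2 ^ e)     ≡⟨ ℕP.^-*-assoc b 2 (2 ^ e) ⟩
    b ^ (2 ^ suc e)       ∎
    where open ℕP.≤-Reasoning

  MonotoneReads : ℕ → List (Fin n) → Subset n → Set
  MonotoneReads j S X = ∀ i → 1 ≤ i → i ≤ j → Monotone (restrict X (nthOcc i S))

  first-read : (S : List (Fin n)) → nthOcc 1 S ≡ allFin n → n ≤ ∣ ⊤ {n} ∣ ^ (2 ^ 0) × MonotoneReads 1 S ⊤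
  first-read S first = ℕP.≤-reflexive (sym (trans (ℕP.*-identityʳ _) (∣⊤∣≡n n))) , monotone
    where
    monotone : MonotoneReads 1 S ⊤
    monotone .1 (s≤s z≤n) (s≤s z≤n) =
      monotonic-⊆ (filter-⊆ (_∈? ⊤) (nthOcc 1 S))
        (inj₁ (subst (Linked Fin._<_) (sym first) (AllPairs⇒Linked (AllPairs.tabulate⁺-< id))))

  next-read : ∀ {k} (S : List (Fin n)) → ReadK k S → ∀ {j} → 2 + j ≤ k → (X : Subset n) →
              n ≤ ∣ X ∣ ^ (2 ^ j) → MonotoneReads (1 + j) S X →
              ∃ λ Y → n ≤ ∣ Y ∣ ^ (2 ^ (1 + j)) × MonotoneReads (2 + j) S Y
  next-read S readK {j} j+2≤k X n≤|X|^ X-reads with refine T T-unique T-complete X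
    where
    T = nthOcc (2 + j) S
    once : ∀ x → count x T ≡ 1
    once = nthOcc-once S readK (s≤s z≤n) j+2≤k
    T-unique : Unique T
    T-unique = count≤1⇒Unique T (ℕP.≤-reflexive ∘ once)
    T-complete : ∀ x → x ∈ₗ T
    T-complete x = count-pos⇒∈ T (ℕP.≤-reflexive (sym (once x)))
  ... | Y , Y⊆X , |X|≤|Y|² , T|Y-monotone = Y , ℕP.≤-trans n≤|X|^ (^-square j |X|≤|Y|²) , Y-reads
    where
    Y-reads : MonotoneReads (2 + j) S Y
    Y-reads i 1≤i i≤j+2 with ℕP.m≤n⇒m<n∨m≡n i≤j+2
    ... | inj₁ (s≤s i≤j+1) =
      monotonic-⊆ (filter⁺ (_∈? Y) (_∈? X) (λ { refl → Y⊆X }) (⊆-refl {x = nthOcc i S})) (X-reads i 1≤i i≤j+1)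
    ... | inj₂ refl = T|Y-monotone

  handle-reads : ∀ {k} (S : List (Fin n)) → ReadK k S → nthOcc 1 S ≡ allFin n →
                 ∀ j → 1 + j ≤ k → ∃ λ X → n ≤ ∣ X ∣ ^ (2 ^ j) × MonotoneReads (1 + j) S X
  handle-reads S readK first zero    _     = ⊤ , first-read S first
  handle-reads S readK first (suc j) j+2≤k with handle-reads S readK first j (ℕP.≤-trans (ℕP.n≤1+n _) j+2≤k)
  ... | X , n≤|X|^ , X-reads = next-read S readK j+2≤k X n≤|X|^ X-reads

lemma5p5 : (n k : ℕ) → 1 ≤ k → (S : List (Fin n)) → ReadK k S →
    nthOcc 1 S ≡ allFin n →
    Σ (Subset n) (λ X' → n ≤ ∣ X' ∣ ^ (2 ^ (k ∸ 1)) × PerReadMonotone k (restrict X' S))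
lemma5p5 n (suc j) _ S readK first with handle-reads S readK first j ℕP.≤-refl
... | X , n≤|X|^ , X-reads = X , n≤|X|^ , λ i 1≤i i≤k →
  subst Monotone (sym (restrict-nthOccGo i X [] S)) (X-reads i 1≤i i≤k)
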